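{- For every integer $n>1$ and every $i\in\{1,2,\ldots,\lceil\frac{n-1}{2}\rceil\}$, there exists a tree $T$ of order $n$ with $\sigma^{ - }(T)=i$.
   Context: For a connected simple graph $G$ of order $p$, a parity labelling is a bijection $f:V(G)\to\{1,\ldots,p\}$; an edge $uv$ is negative if $f(u),f(v)$ have opposite parity. The rna number $\sigma^{ - }(G)$ is the minimum over all such $f$ of the number of negative edges. -}

module Defs where

open import Data.Nat using (ℕ; zero; suc; _+_; _<ᵇ_; _%_; _≡ᵇ_; _≥_; _≤_)
open import Data.Bool using (Bool; true; false; _∧_; not; if_then_else_)
open import Data.Fin using (Fin; toℕ)
open import Data.List using (List; []; _∷_; length; map; last)
open import Data.Nat.ListAction using (sum)
open import Data.List.Relation.Unary.Unique.Propositional using (Unique)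
open import Data.List.Relation.Unary.Linked using (Linked)
open import Data.Maybe using (Maybe; just; nothing)
open import Data.List using (allFin)
open import Data.Product using (Σ; _×_; ∃-syntax; _,_)
open import Relation.Binary.PropositionalEquality using (_≡_)
open import Relation.Nullary using (¬_)
open import Function.Bundles using (_⤖_; Bijection)

record SimpleGraph (n : ℕ) : Set where
  field
    adj   : Fin n → Fin n → Bool
    sym   : ∀ u v → adj u v ≡ adj v u
    irrefl : ∀ u → adj u u ≡ false
open SimpleGraph public

Adj : ∀ {n} → SimpleGraph n → Fin n → Fin n → Set
Adj G u v = adj G u v ≡ true

data Walk {n : ℕ} (G : SimpleGraph n) : Fin n → Fin n → Set where
  nil  : ∀ {u} → Walk G u u
  cons : ∀ {u w v} → Adj G u w → Walk G w v → Walk G u v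

Connected : ∀ {n} → SimpleGraph n → Set
Connected {n} G = ∀ (u v : Fin n) → Walk G u v

IsCycle : ∀ {n} → SimpleGraph n → List (Fin n) → Set
IsCycle G [] = Data.Empty.⊥ where import Data.Empty
IsCycle G (x ∷ xs) =
  length (x ∷ xs) ≥ 3 × Unique (x ∷ xs) × Linked (Adj G) (x ∷ xs)
  × (∃[ y ] (last (x ∷ xs) ≡ just y × Adj G y x))

Acyclic : ∀ {n} → SimpleGraph n → Set
Acyclic {n} G = ∀ (c : List (Fin n)) → ¬ IsCycle G c

IsTree : ∀ {n} → SimpleGraph n → Set
IsTree G = Connected G × Acyclic G

Labelling : ℕ → Set
Labelling n = Fin n ⤖ Fin n

label : ∀ {n} → Labelling n → Fin n → ℕ
label f u = suc (toℕ (Bijection.to f u))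

oppositeParity : ℕ → ℕ → Bool
oppositeParity a b = not ((a % 2) ≡ᵇ (b % 2))

negEdges : ∀ {n} → SimpleGraph n → Labelling n → ℕ
negEdges {n} G f =
  sum (map (λ u → sum (map (λ v →
    if (toℕ u <ᵇ toℕ v) ∧ adj G u v ∧ oppositeParity (label f u) (label f v)
    then 1 else 0) (allFin n))) (allFin n))

-- σ⁻(G) = k : k is the minimum over labellings of the number of negative edges.
RnaNumber : ∀ {n} → SimpleGraph n → ℕ → Set
RnaNumber {n} G k =
  (Σ (Labelling n) λ f → negEdges G f ≡ k) × (∀ (f : Labelling n) → k ≤ negEdges G f)

-- The tree is a double star: adjacent centres 0 and 1 (labels 1 and 2 under
-- the identity labelling), the k = ⌊n/2⌋ − i odd vertices 3, 5, …, 2k+1 as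
-- leaves at centre 1, and all remaining vertices as leaves at centre 0.
-- Under any labelling at least ⌊n/2⌋ vertices have parity opposite to vertex
-- 0, and all of them except at most the k non-neighbours of 0 give negative
-- edges at 0, so σ⁻ ≥ ⌊n/2⌋ − k = i. The identity labelling attains the bound:
-- the leaves at centre 1 carry even labels like centre 1 itself, so its
-- negative edges are exactly those from 0 to the remaining even labels.

module Submission where

open import Defs hiding (sym)
open import Data.Nat using (ℕ; zero; suc; _+_; _∸_; _<_; _≤_; _<ᵇ_; ⌊_/2⌋; ⌈_/2⌉; z≤n; s≤s; s≤s⁻¹)
open import Data.Nat.Properties
  using (≤-refl; ≤-trans; ≤-reflexive; m≤m+n; +-mono-≤; +-cancelʳ-≡; +-cancelʳ-≤; +-identityʳ; ⌊n/2⌋≤⌈n/2⌉; ∸-monoʳ-≤; m+[n∸m]≡n; +-0-commutativeMonoid)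
open import Data.Bool using (Bool; true; false; _∧_; not; if_then_else_)
open import Data.Bool.Properties using (not-involutive; not-¬; ∧-zeroʳ)
open import Data.Fin using (Fin; zero; suc; toℕ) renaming (_<_ to _<ᶠ_)
open import Data.Fin.Induction using (<-wellFounded)
open import Data.List using ([]; _∷_; map; allFin; tabulate; last)
open import Data.List.Properties using (map-tabulate; map-cong)
open import Data.List.Relation.Unary.All using (All; _∷_)
open import Data.List.Relation.Unary.AllPairs using (_∷_)
open import Data.List.Relation.Unary.Linked using ([-]; _∷_)
open import Data.Maybe using (just)
open import Data.Nat.ListAction using (sum)
open import Data.Product using (Σ; _×_; _,_; ∃-syntax)
open import Data.Empty using (⊥; ⊥-elim)
open import Function.Construct.Identity using (⤖-id)
open import Function.Properties.Bijection using (⤖⇒↔)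
open import Induction.WellFounded using (Acc; acc)
open import Relation.Binary.PropositionalEquality using (_≡_; _≢_; refl; sym; trans; cong)
open Data.Nat.Properties.≤-Reasoning
open import Algebra.Properties.CommutativeMonoid.Sum +-0-commutativeMonoid
  using (sum-syntax; ∑-distrib-+; sum-cong-≗; sum-replicate-zero; sum-permute)
  renaming (sum to ∑)

[_] : Bool → ℕ
[ b ] = if b then 1 else 0

[b]≤[a∧b]+[¬a] : ∀ a b → [ b ] ≤ [ a ∧ b ] + [ not a ]
[b]≤[a∧b]+[¬a] true  b     = m≤m+n [ b ] 0
[b]≤[a∧b]+[¬a] false true = ≤-refl
[b]≤[a∧b]+[¬a] false false = z≤n

[¬a∧b]+[a]≡[b] : ∀ a b → (a ≡ true → b ≡ true) → [ not a ∧ b ] + [ a ] ≡ [ b ]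
[¬a∧b]+[a]≡[b] true  b a⇒b rewrite a⇒b refl = refl
[¬a∧b]+[a]≡[b] false true  _ = refl
[¬a∧b]+[a]≡[b] false false _ = refl

oppositeParity-refl : ∀ a → oppositeParity a a ≡ false
oppositeParity-refl zero          = refl
oppositeParity-refl (suc zero)    = refl
oppositeParity-refl (suc (suc a)) = oppositeParity-refl a

oppositeParity-sucˡ : ∀ a b → oppositeParity (suc a) b ≡ not (oppositeParity a b)
oppositeParity-sucˡ zero          zero          = refl
oppositeParity-sucˡ zero          (suc zero)    = refl
oppositeParity-sucˡ zero          (suc (suc b)) = oppositeParity-sucˡ zero b
oppositeParity-sucˡ (suc zero)    zero          = refl
oppositeParity-sucˡ (suc zero)    (suc zero)    = refl
oppositeParity-sucˡ (suc zero)    (suc (suc b)) = oppositeParity-sucˡ (suc zero) b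
oppositeParity-sucˡ (suc (suc a)) b             = oppositeParity-sucˡ a b

#oddLabels : ∀ n → ∑[ j < n ] [ oppositeParity 0 (suc (toℕ j)) ] ≡ ⌈ n /2⌉
#oddLabels zero          = refl
#oddLabels (suc zero)    = refl
#oddLabels (suc (suc n)) = cong suc (#oddLabels n)

#evenLabels : ∀ n → ∑[ j < n ] [ oppositeParity 1 (suc (toℕ j)) ] ≡ ⌊ n /2⌋
#evenLabels zero          = refl
#evenLabels (suc zero)    = refl
#evenLabels (suc (suc n)) = cong suc (#evenLabels n)

⌊n/2⌋≤#oppositeLabels : ∀ a n → ⌊ n /2⌋ ≤ ∑[ j < n ] [ oppositeParity a (suc (toℕ j)) ]
⌊n/2⌋≤#oppositeLabels zero          n = ≤-trans (⌊n/2⌋≤⌈n/2⌉ n) (≤-reflexive (sym (#oddLabels n)))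
⌊n/2⌋≤#oppositeLabels (suc zero)    n = ≤-reflexive (sym (#evenLabels n))
⌊n/2⌋≤#oppositeLabels (suc (suc a)) n = ⌊n/2⌋≤#oppositeLabels a n

sum-tabulate : ∀ {n} (f : Fin n → ℕ) → sum (tabulate f) ≡ ∑[ i < n ] f i
sum-tabulate {zero}  f = refl
sum-tabulate {suc n} f = cong (f zero +_) (sum-tabulate (λ i → f (suc i)))

sum-allFin : ∀ {n} (f : Fin n → ℕ) → sum (map f (allFin n)) ≡ ∑[ i < n ] f i
sum-allFin f = trans (cong sum (map-tabulate (λ i → i) f)) (sum-tabulate f)

∑-mono-≤ : ∀ {n} {f g : Fin n → ℕ} → (∀ i → f i ≤ g i) → ∑[ i < n ] f i ≤ ∑[ i < n ] g i
∑-mono-≤ {zero}  f≤g = z≤n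
∑-mono-≤ {suc n} f≤g = +-mono-≤ (f≤g zero) (∑-mono-≤ (λ i → f≤g (suc i)))

∑-zero : ∀ {n} {f : Fin n → ℕ} → (∀ i → f i ≡ 0) → ∑[ i < n ] f i ≡ 0
∑-zero {n} f≡0 = trans (sum-cong-≗ f≡0) (sum-replicate-zero n)

module _ {n} {G : SimpleGraph n} where

  _++ʷ_ : ∀ {u v w} → Walk G u v → Walk G v w → Walk G u w
  nil       ++ʷ q = q
  cons uw p ++ʷ q = cons uw (p ++ʷ q)

  reverseʷ : ∀ {u v} → Walk G u v → Walk G v u
  reverseʷ nil                      = nil
  reverseʷ {u} (cons {w = w} uw p) = reverseʷ p ++ʷ cons (trans (SimpleGraph.sym G w u) uw) nil

connected-if-descending : ∀ {m} (G : SimpleGraph (suc m)) →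
  (∀ v → ∃[ u ] (u <ᶠ suc v × Adj G (suc v) u)) → Connected G
connected-if-descending G descend u v = toZero u (<-wellFounded u) ++ʷ reverseʷ (toZero v (<-wellFounded v))
  where
  toZero : ∀ v → Acc _<ᶠ_ v → Walk G v zero
  toZero zero    _        = nil
  toZero (suc v) (acc rs) with descend v
  ... | u , u<v , vu = cons vu (toZero u (rs u<v))

data Centre {m} : Fin (suc (suc m)) → Set where
  centre₀ : Centre zero
  centre₁ : Centre (suc zero)

noThreeDistinctCentres : ∀ {m} {x y z : Fin (suc (suc m))} →
  Centre x → Centre y → Centre z → x ≢ y → x ≢ z → y ≢ z → ⊥
noThreeDistinctCentres centre₀ centre₀ _       x≢y _   _   = x≢y refl
noThreeDistinctCentres centre₁ centre₁ _       x≢y _   _   = x≢y refl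
noThreeDistinctCentres centre₀ centre₁ centre₀ _   x≢z _   = x≢z refl
noThreeDistinctCentres centre₀ centre₁ centre₁ _   _   y≢z = y≢z refl
noThreeDistinctCentres centre₁ centre₀ centre₀ _   _   y≢z = y≢z refl
noThreeDistinctCentres centre₁ centre₀ centre₁ _   x≢z _   = x≢z refl

All-last : ∀ {A : Set} {P : A → Set} {x xs y} → All P (x ∷ xs) → last (x ∷ xs) ≡ just y → P y
All-last {xs = []}    (px ∷ _)  refl = px
All-last {xs = _ ∷ _} (_ ∷ pxs) eq   = All-last pxs eq

LeavesBeyondCentres : ∀ {m} → SimpleGraph (suc (suc m)) → Set
LeavesBeyondCentres G = ∀ {x z} w → Adj G x (suc (suc w)) → Adj G z (suc (suc w)) → x ≡ z

module _ {m} (G : SimpleGraph (suc (suc m))) (leaf : LeavesBeyondCentres G) where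

  centre-between : ∀ {u v w} → Adj G u v → Adj G v w → u ≢ w → Centre v
  centre-between {v = zero}          _  _  _   = centre₀
  centre-between {v = suc zero}      _  _  _   = centre₁
  centre-between {v = suc (suc v)} {w} uv vw u≢w =
    ⊥-elim (u≢w (leaf v uv (trans (SimpleGraph.sym G w _) vw)))

  -- Every vertex of a cycle has two distinct neighbours on it, so a cycle
  -- through three distinct vertices would need three centres.
  acyclic-if-leaves : Acyclic G
  acyclic-if-leaves []           ()
  acyclic-if-leaves (_ ∷ [])     (s≤s () , _)
  acyclic-if-leaves (_ ∷ _ ∷ []) (s≤s (s≤s ()) , _)
  acyclic-if-leaves (x ∷ a ∷ b ∷ [])
    (_ , (x≢a ∷ x≢b ∷ _) ∷ (a≢b ∷ _) ∷ _ , xa ∷ ab ∷ [-] , _ , refl , bx) =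
    noThreeDistinctCentres (centre-between bx xa (λ b≡a → a≢b (sym b≡a))) (centre-between xa ab x≢b)
      (centre-between ab bx (λ a≡x → x≢a (sym a≡x))) x≢a x≢b a≢b
  acyclic-if-leaves (x ∷ a ∷ b ∷ c ∷ cs)
    (_ , (x≢a ∷ x≢b ∷ _) ∷ (a≢b ∷ a≢c ∷ a≢cs) ∷ _ , xa ∷ ab ∷ bc ∷ _ , _ , last≡y , yx) =
    noThreeDistinctCentres (centre-between yx xa (λ y≡a → All-last (a≢c ∷ a≢cs) last≡y (sym y≡a)))
      (centre-between xa ab x≢b) (centre-between ab bc a≢c) x≢a x≢b a≢b

isNegative : ∀ {n} → SimpleGraph n → Labelling n → Fin n → Fin n → Bool
isNegative G f u v = (toℕ u <ᵇ toℕ v) ∧ adj G u v ∧ oppositeParity (label f u) (label f v)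

negEdgesAt : ∀ {n} → SimpleGraph n → Labelling n → Fin n → ℕ
negEdgesAt {n} G f u = ∑[ v < n ] [ isNegative G f u v ]

negEdges≡∑negEdgesAt : ∀ {n} (G : SimpleGraph n) (f : Labelling n) →
  negEdges G f ≡ ∑[ u < n ] negEdgesAt G f u
negEdges≡∑negEdgesAt G f =
  trans (cong sum (map-cong (λ u → sum-allFin (λ v → [ isNegative G f u v ])) (allFin _)))
        (sum-allFin (negEdgesAt G f))

negEdgesAt-zero≤negEdges : ∀ {m} (G : SimpleGraph (suc m)) (f : Labelling (suc m)) →
  negEdgesAt G f zero ≤ negEdges G f
negEdgesAt-zero≤negEdges G f = ≤-trans (m≤m+n _ _) (≤-reflexive (sym (negEdges≡∑negEdgesAt G f)))

⌊n/2⌋≤#oppositeTo : ∀ {n} (f : Labelling n) u → ⌊ n /2⌋ ≤ ∑[ v < n ] [ oppositeParity (label f u) (label f v) ]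
⌊n/2⌋≤#oppositeTo {n} f u = begin
  ⌊ n /2⌋                                                       ≤⟨ ⌊n/2⌋≤#oppositeLabels (label f u) n ⟩
  ∑[ j < n ] [ oppositeParity (label f u) (suc (toℕ j)) ]       ≡⟨ sum-permute _ (⤖⇒↔ f) ⟩
  ∑[ v < n ] [ oppositeParity (label f u) (label f v) ]         ∎

nonNeighboursOfZero : ∀ {m} → SimpleGraph (suc m) → ℕ
nonNeighboursOfZero {m} G = ∑[ w < m ] [ not (adj G zero (suc w)) ]

⌊n/2⌋≤negEdges+nonNeighbours : ∀ {m} (G : SimpleGraph (suc m)) (f : Labelling (suc m)) →
  ⌊ suc m /2⌋ ≤ negEdges G f + nonNeighboursOfZero G
⌊n/2⌋≤negEdges+nonNeighbours {m} G f = begin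
  ⌊ suc m /2⌋                                              ≤⟨ ⌊n/2⌋≤#oppositeTo f zero ⟩
  ∑[ v < suc m ] [ opposite v ]                            ≡⟨ cong (λ b → [ b ] + ∑[ w < m ] [ opposite (suc w) ]) (oppositeParity-refl (label f zero)) ⟩
  ∑[ w < m ] [ opposite (suc w) ]                          ≤⟨ ∑-mono-≤ (λ w → [b]≤[a∧b]+[¬a] (adj G zero (suc w)) _) ⟩
  ∑[ w < m ] ([ isNegative G f zero (suc w) ] + [ not (adj G zero (suc w)) ])
                                                           ≡⟨ ∑-distrib-+ (λ w → [ isNegative G f zero (suc w) ]) (λ w → [ not (adj G zero (suc w)) ]) ⟩
  negEdgesAt G f zero + nonNeighboursOfZero G              ≤⟨ +-mono-≤ (negEdgesAt-zero≤negEdges G f) ≤-refl ⟩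
  negEdges G f + nonNeighboursOfZero G                     ∎
  where
  opposite : Fin (suc m) → Bool
  opposite v = oppositeParity (label f zero) (label f v)

doubleStarAdj : (ℕ → Bool) → ℕ → ℕ → Bool
doubleStarAdj atOne 0             1             = true
doubleStarAdj atOne 1             0             = true
doubleStarAdj atOne 0             (suc (suc b)) = not (atOne b)
doubleStarAdj atOne (suc (suc b)) 0             = not (atOne b)
doubleStarAdj atOne 1             (suc (suc b)) = atOne b
doubleStarAdj atOne (suc (suc b)) 1             = atOne b
doubleStarAdj atOne _             _             = false

doubleStarAdj-sym : ∀ atOne u v → doubleStarAdj atOne u v ≡ doubleStarAdj atOne v u
doubleStarAdj-sym atOne 0             0             = refl
doubleStarAdj-sym atOne 0             1             = refl
doubleStarAdj-sym atOne 0             (suc (suc _)) = refl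
doubleStarAdj-sym atOne 1             0             = refl
doubleStarAdj-sym atOne 1             1             = refl
doubleStarAdj-sym atOne 1             (suc (suc _)) = refl
doubleStarAdj-sym atOne (suc (suc _)) 0             = refl
doubleStarAdj-sym atOne (suc (suc _)) 1             = refl
doubleStarAdj-sym atOne (suc (suc _)) (suc (suc _)) = refl

doubleStarAdj-irrefl : ∀ atOne u → doubleStarAdj atOne u u ≡ false
doubleStarAdj-irrefl atOne 0             = refl
doubleStarAdj-irrefl atOne 1             = refl
doubleStarAdj-irrefl atOne (suc (suc _)) = refl

doubleStar : (ℕ → Bool) → (n : ℕ) → SimpleGraph n
doubleStar atOne n = record
  { adj    = λ u v → doubleStarAdj atOne (toℕ u) (toℕ v)
  ; sym    = λ u v → doubleStarAdj-sym atOne (toℕ u) (toℕ v)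
  ; irrefl = λ u → doubleStarAdj-irrefl atOne (toℕ u)
  }

module _ (atOne : ℕ → Bool) {m : ℕ} where

  private
    G : SimpleGraph (suc (suc m))
    G = doubleStar atOne (suc (suc m))

  doubleStar-descending : ∀ v → ∃[ u ] (u <ᶠ suc v × Adj G (suc v) u)
  doubleStar-descending zero = zero , s≤s z≤n , refl
  doubleStar-descending (suc w) with atOne (toℕ w) in eq
  ... | true  = suc zero , s≤s (s≤s z≤n) , eq
  ... | false = zero , s≤s z≤n , cong not eq

  doubleStar-leaves : LeavesBeyondCentres G
  doubleStar-leaves {zero}          {zero}          _ _   _   = refl
  doubleStar-leaves {suc zero}      {suc zero}      _ _   _   = refl
  doubleStar-leaves {zero}          {suc zero}      _ x~w z~w = ⊥-elim (not-¬ (sym z~w) (sym x~w))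
  doubleStar-leaves {suc zero}      {zero}          _ x~w z~w = ⊥-elim (not-¬ (sym x~w) (sym z~w))
  doubleStar-leaves {suc (suc _)}   {_}             _ ()  _
  doubleStar-leaves {zero}          {suc (suc _)}   _ _   ()
  doubleStar-leaves {suc zero}      {suc (suc _)}   _ _   ()

  doubleStar-isTree : IsTree G
  doubleStar-isTree = connected-if-descending G doubleStar-descending , acyclic-if-leaves G doubleStar-leaves

  #atOne : ℕ
  #atOne = ∑[ b < m ] [ atOne (toℕ b) ]

  nonNeighboursOfZero-doubleStar : nonNeighboursOfZero G ≡ #atOne
  nonNeighboursOfZero-doubleStar = sum-cong-≗ {m} (λ b → cong [_] (not-involutive (atOne (toℕ b))))

  -- Vertex v carries label v + 1 under the identity labelling, so this says
  -- that the leaves at centre 1 get even labels.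
  module _ (evenAtOne : ∀ b → atOne b ≡ true → oppositeParity 1 (3 + b) ≡ true) where

    identity : Labelling (suc (suc m))
    identity = ⤖-id _

    positiveEdgesBeyondZero : ∀ u v → isNegative G identity (suc u) v ≡ false
    positiveEdgesBeyondZero zero    zero          = refl
    positiveEdgesBeyondZero zero    (suc zero)    = refl
    positiveEdgesBeyondZero zero    (suc (suc w)) with atOne (toℕ w) in eq
    ... | true  = trans (oppositeParity-sucˡ 1 (3 + toℕ w)) (cong not (evenAtOne (toℕ w) eq))
    ... | false = refl
    positiveEdgesBeyondZero (suc _) zero          = refl
    positiveEdgesBeyondZero (suc _) (suc zero)    = refl
    positiveEdgesBeyondZero (suc _) (suc (suc w)) = ∧-zeroʳ _

    negEdges-identity : negEdges G identity + #atOne ≡ ⌊ suc (suc m) /2⌋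
    negEdges-identity = begin-equality
      negEdges G identity + #atOne
        ≡⟨ cong (_+ #atOne) (negEdges≡∑negEdgesAt G identity) ⟩
      negEdgesAt G identity zero + ∑[ u < suc m ] negEdgesAt G identity (suc u) + #atOne
        ≡⟨ cong (λ r → negEdgesAt G identity zero + r + #atOne)
                (∑-zero (λ u → ∑-zero (λ v → cong [_] (positiveEdgesBeyondZero u v)))) ⟩
      negEdgesAt G identity zero + 0 + #atOne
        ≡⟨ cong (_+ #atOne) (+-identityʳ _) ⟩
      suc (∑[ b < m ] [ not (atOne (toℕ b)) ∧ even (toℕ b) ] + #atOne)
        ≡⟨ cong suc (sym (∑-distrib-+ {m} (λ b → [ not (atOne (toℕ b)) ∧ even (toℕ b) ]) (λ b → [ atOne (toℕ b) ]))) ⟩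
      suc (∑[ b < m ] ([ not (atOne (toℕ b)) ∧ even (toℕ b) ] + [ atOne (toℕ b) ]))
        ≡⟨ cong suc (sum-cong-≗ {m} (λ b → [¬a∧b]+[a]≡[b] (atOne (toℕ b)) _ (evenAtOne (toℕ b)))) ⟩
      suc (∑[ b < m ] [ even (toℕ b) ])
        ≡⟨ cong suc (#evenLabels m) ⟩
      ⌊ suc (suc m) /2⌋ ∎
      where
      even : ℕ → Bool
      even b = oppositeParity 1 (3 + b)

    rnaNumber-doubleStar : ∀ σ → σ + #atOne ≡ ⌊ suc (suc m) /2⌋ → RnaNumber G σ
    rnaNumber-doubleStar σ σ+#atOne≡ =
      (identity , +-cancelʳ-≡ #atOne _ σ (trans negEdges-identity (sym σ+#atOne≡))) , λ f →
      +-cancelʳ-≤ #atOne σ _ (begin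
        σ + #atOne                           ≡⟨ σ+#atOne≡ ⟩
        ⌊ suc (suc m) /2⌋                    ≤⟨ ⌊n/2⌋≤negEdges+nonNeighbours G f ⟩
        negEdges G f + nonNeighboursOfZero G ≡⟨ cong (negEdges G f +_) nonNeighboursOfZero-doubleStar ⟩
        negEdges G f + #atOne                ∎)

firstOdds : ℕ → ℕ → Bool
firstOdds zero    _             = false
firstOdds (suc k) 0             = false
firstOdds (suc k) 1             = true
firstOdds (suc k) (suc (suc b)) = firstOdds k b

#firstOdds : ∀ k m → k ≤ ⌊ m /2⌋ → ∑[ b < m ] [ firstOdds k (toℕ b) ] ≡ k
#firstOdds zero    m             _  = ∑-zero {m} (λ _ → refl)
#firstOdds (suc k) (suc (suc m)) k≤ = cong suc (#firstOdds k m (s≤s⁻¹ k≤))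

firstOdds-even : ∀ k b → firstOdds k b ≡ true → oppositeParity 1 (3 + b) ≡ true
firstOdds-even (suc k) 1             _  = refl
firstOdds-even (suc k) (suc (suc b)) eq = firstOdds-even k b eq

mainTheorem9 : ∀ (n : ℕ) → 1 < n → ∀ (i : ℕ) → 1 ≤ i → i ≤ ⌈ (n ∸ 1) /2⌉ →
    Σ (SimpleGraph n) λ T → IsTree T × RnaNumber T i
mainTheorem9 (suc zero)    (s≤s ())
mainTheorem9 (suc (suc m)) _ i 1≤i i≤⌊n/2⌋ =
  doubleStar (firstOdds k) (suc (suc m)) ,
  doubleStar-isTree (firstOdds k) ,
  rnaNumber-doubleStar (firstOdds k) (firstOdds-even k) i (begin-equality
    i + ∑[ b < m ] [ firstOdds k (toℕ b) ] ≡⟨ cong (i +_) (#firstOdds k m (∸-monoʳ-≤ ⌊ suc (suc m) /2⌋ 1≤i)) ⟩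
    i + k                                  ≡⟨ m+[n∸m]≡n i≤⌊n/2⌋ ⟩
    ⌊ suc (suc m) /2⌋                      ∎)
  where
  k : ℕ
  k = ⌊ suc (suc m) /2⌋ ∸ i
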